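{- Let $h\ge 0$ be an integer and let $f,g:\mathbb{N}\to\mathbb{C}$ have finite Ramanujan expansions, i.e. their Eratosthenes transforms $f'=f\ast\mu$ and $g'=g\ast\mu$ have finite support, so that $f(n)=\sum_{r}\widehat f(r)c_r(n)$, $g(m)=\sum_s\widehat g(s)c_s(m)$ with finitely many nonzero coefficients $\widehat f(r)=\sum_{m\equiv 0\bmod r}f'(m)/m$, $\widehat g(s)=\sum_{m\equiv0\bmod s}g'(m)/m$. Then $$\mathfrak{S}_{f,g}(h)=\sum_{l\mid h} l\sum_{d}\frac{f'(d)}{d}\sum_{\substack{q\\ (q,d)=l}}\frac{g'(q)}{q},$$ where, when $h=0$, the condition $l\mid h$ means that $l$ runs over all integers $l\ge1$.
   Context: $\mathfrak{S}_{f,g}(h)=\sum_{q\ge1}\widehat f(q)\widehat g(q)c_q(h)$ is the singular series, where $c_q(h)=\sum_{1\le a\le q,(a,q)=1}e^{2\pi i ah/q}=\sum_{d\mid q,d\mid h}d\mu(q/d)$ is the Ramanujan sum and $\mu$ the Möbius function. -}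

module Defs where

open import Level using (Level)
open import Data.Nat using (ℕ; zero; suc; _<_)
open import Data.Nat.Divisibility using (_∣_; _∣?_; divides)
open import Data.Nat.Primality using (prime?)
open import Data.Nat.GCD using (gcd)
open import Data.Integer as ℤ using (ℤ; +_; -[1+_])
open import Data.Bool using (Bool; true; false; if_then_else_; _∨_)
open import Relation.Nullary.Decidable using (⌊_⌋; yes; no)
open import Relation.Binary.PropositionalEquality using (_≡_)
open import Algebra.Bundles using (CommutativeRing)

countTo : ℕ → (ℕ → Bool) → ℕ
countTo zero    P = 0
countTo (suc n) P = (if P (suc n) then 1 else 0) Data.Nat.+ countTo n P

anyTo : ℕ → (ℕ → Bool) → Bool
anyTo zero    P = false
anyTo (suc n) P = P (suc n) ∨ anyTo n P

hasSquareFactor : ℕ → Bool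
hasSquareFactor n = anyTo n (λ k → ⌊ 2 Data.Nat.≤? k ⌋ Data.Bool.∧ ⌊ (k Data.Nat.* k) ∣? n ⌋)

ω : ℕ → ℕ
ω n = countTo n (λ p → ⌊ prime? p ⌋ Data.Bool.∧ ⌊ p ∣? n ⌋)

negOnePow : ℕ → ℤ
negOnePow zero    = + 1
negOnePow (suc k) = ℤ.- negOnePow k

-- Möbius function (on n ≥ 1; μ 0 = 0 by convention, never used)
μ : ℕ → ℤ
μ zero = + 0
μ n@(suc _) = if hasSquareFactor n then + 0 else negOnePow (ω n)

-- Ramanujan sum c_q(h) = Σ_{d ∣ q, d ∣ h} d μ(q/d)   (q ≥ 1, h ≥ 0)
ramanujan : ℕ → ℕ → ℤ
ramanujan q h = go q
  where
  term : ℕ → ℤ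
  term d with d ∣? q | d ∣? h
  ... | yes (divides e _) | yes _ = + d ℤ.* μ e
  ... | _ | _ = + 0
  go : ℕ → ℤ
  go zero    = + 0
  go (suc k) = go k ℤ.+ term (suc k)

-- Functions with values in a commutative ring R in which positive
-- integers are invertible (a stand-in for ℂ; `inv n` is 1/n).

module WithRing {c ℓ : Level} (R : CommutativeRing c ℓ)
                (inv : ℕ → CommutativeRing.Carrier R) where

  open CommutativeRing R

  ιℕ : ℕ → Carrier
  ιℕ zero    = 0#
  ιℕ (suc n) = 1# + ιℕ n

  ιℤ : ℤ → Carrier
  ιℤ (+ n)     = ιℕ n
  ιℤ -[1+ n ]  = - ιℕ (suc n)

  InvertsPositive : Set ℓ
  InvertsPositive = ∀ n → ιℕ (suc n) * inv (suc n) ≈ 1#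

  sumTo : ℕ → (ℕ → Carrier) → Carrier
  sumTo zero    F = 0#
  sumTo (suc n) F = sumTo n F + F (suc n)

  when : Bool → Carrier → Carrier
  when b x = if b then x else 0#

  eratosthenes : (ℕ → Carrier) → ℕ → Carrier
  eratosthenes f n = sumTo n term
    where
    term : ℕ → Carrier
    term d with d ∣? n
    ... | yes (divides e _) = f d * ιℤ (μ e)
    ... | no _ = 0#

  SupportedUpTo : ℕ → (ℕ → Carrier) → Set ℓ
  SupportedUpTo N f' = ∀ m → N < m → f' m ≈ 0#

  ramanujanCoeff : ℕ → (ℕ → Carrier) → ℕ → Carrier
  ramanujanCoeff N f r =
    sumTo N (λ m → when ⌊ r ∣? m ⌋ (eratosthenes f m * inv m))

  -- singular series  S_{f,g}(h) = Σ_{q ≥ 1} f̂(q) ĝ(q) c_q(h)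
  -- (terms with q > N vanish, since f̂(q) = 0 there)
  singularSeries : ℕ → (ℕ → Carrier) → (ℕ → Carrier) → ℕ → Carrier
  singularSeries N f g h =
    sumTo N (λ q → ramanujanCoeff N f q * ramanujanCoeff N g q * ιℤ (ramanujan q h))

  -- right-hand side:  Σ_{l ∣ h} l Σ_d f'(d)/d Σ_{(q,d)=l} g'(q)/q
  -- (for h = 0 every l divides h, matching the paper's convention;
  --  terms with l > N vanish since (q,d) ≤ d ≤ N on the support)
  rhsA6 : ℕ → (ℕ → Carrier) → (ℕ → Carrier) → ℕ → Carrier
  rhsA6 N f g h =
    sumTo N (λ l → when ⌊ l ∣? h ⌋
      (ιℕ l * sumTo N (λ d → eratosthenes f d * inv d *
         sumTo N (λ q → when ⌊ gcd q d Data.Nat.≟ l ⌋ (eratosthenes g q * inv q)))))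

-- Expanding f̂(q) ĝ(q) = Σ_{d,e} [q ∣ d] [q ∣ e] f′(d)/d · g′(e)/e and exchanging the sums turns
-- the singular series into Σ_{d,e} f′(d)/d · g′(e)/e · Σ_{q ∣ (e,d)} c_q(h).  Writing
-- c_q(h) = Σ_{l ∣ q, l ∣ h} l μ(q/l) and using Σ_{l ∣ q ∣ g} μ(q/l) = [g = l] gives the classical
-- Σ_{q ∣ g} c_q(h) = g [g ∣ h].  On the right-hand side the condition (e,d) = l singles out one l,
-- so both sides equal Σ_{d,e} f′(d)/d · g′(e)/e · (e,d) [(e,d) ∣ h].
module Submission where

open import Defs
open import Data.Nat using (ℕ)
open import Algebra.Bundles using (CommutativeRing)

module Arithmetic where

  open import Data.Bool using (Bool; true; false; if_then_else_; _∧_; _∨_)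
  open import Data.Bool.Properties using (∧-zeroʳ; ∨-zeroʳ; ∨-identityʳ; ⇔→≡)
  open import Data.Integer as ℤ using (ℤ; +_)
  open import Data.List using ([]; _∷_)
  open import Data.List.Relation.Unary.All using (_∷_)
  open import Data.Nat
  open import Data.Nat.Coprimality as Coprimality using (Coprime; coprime-divisor)
  open import Data.Nat.Divisibility
  open import Data.Nat.GCD using (gcd; gcd[m,n]∣m; gcd[m,n]∣n; gcd-greatest)
  open import Data.Nat.ListAction using (product)
  open import Data.Nat.Primality
  open import Data.Nat.Primality.Factorisation using (factorise)
  open import Data.Nat.Properties
  open import Data.Product using (∃-syntax; _×_; _,_)
  open import Data.Sum using (inj₁; inj₂; [_,_]′)
  open import Function using (_∘_)
  open import Function.Bundles using (mk⇔)
  open import Relation.Binary.PropositionalEquality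
  open import Relation.Nullary using (yes; no; ¬_; contradiction)
  open import Relation.Nullary.Decidable using (Dec; ⌊_⌋; dec-true; dec-false; isYes≗does)

  ⌊⌋-true : ∀ {a} {A : Set a} (a? : Dec A) → A → ⌊ a? ⌋ ≡ true
  ⌊⌋-true a? a = trans (isYes≗does a?) (dec-true a? a)

  ⌊⌋-false : ∀ {a} {A : Set a} (a? : Dec A) → ¬ A → ⌊ a? ⌋ ≡ false
  ⌊⌋-false a? ¬a = trans (isYes≗does a?) (dec-false a? ¬a)

  ⌊⌋-⇔ : ∀ {a b} {A : Set a} {B : Set b} (a? : Dec A) (b? : Dec B) → (A → B) → (B → A) → ⌊ a? ⌋ ≡ ⌊ b? ⌋
  ⌊⌋-⇔ (yes _) (yes _)  _ _ = refl
  ⌊⌋-⇔ (yes a) (no ¬b)  f _ = contradiction (f a) ¬b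
  ⌊⌋-⇔ (no ¬a) (yes b)  _ g = contradiction (g b) ¬a
  ⌊⌋-⇔ (no _)  (no _)   _ _ = refl

  prime∤⇒coprime : ∀ {p n} → Prime p → p ∤ n → Coprime p n
  prime∤⇒coprime pr p∤n (d∣p , d∣n) with prime⇒irreducible pr d∣p
  ... | inj₁ d≡1 = d≡1
  ... | inj₂ refl = contradiction d∣n p∤n

  prime-divisor : ∀ n → 2 ≤ n → ∃[ p ] (Prime p × p ∣ n)
  prime-divisor n@(suc _) 2≤n with factorise n
  ... | record { factors = [] ; isFactorisation = n≡1 } = contradiction (subst (2 ≤_) n≡1 2≤n) λ { (s≤s ()) }
  ... | record { factors = p ∷ ps ; isFactorisation = n≡∏ ; factorsPrime = pr ∷ _ } =
    p , pr , subst (p ∣_) (sym n≡∏) (m∣m*n (product ps))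

  ∤-offset : ∀ {l k} m → 1 ≤ k → k < l → l ∤ k + m * l
  ∤-offset {l} {k} m 1≤k k<l l∣k+ml = <⇒≱ k<l (∣⇒≤ l∣k)
    where
    instance _ = >-nonZero 1≤k
    l∣k : l ∣ k
    l∣k = ∣m+n∣m⇒∣n (subst (l ∣_) (+-comm k (m * l)) l∣k+ml) (n∣m*n m)

  ∣?-gcd : ∀ q d e → ⌊ q ∣? d ⌋ ∧ ⌊ q ∣? e ⌋ ≡ ⌊ q ∣? gcd e d ⌋
  ∣?-gcd q d e with q ∣? d | q ∣? e | q ∣? gcd e d
  ... | yes _   | yes _   | yes _   = refl
  ... | yes q∣d | yes q∣e | no q∤g  = contradiction (gcd-greatest q∣e q∣d) q∤g
  ... | yes _   | no q∤e  | yes q∣g = contradiction (∣-trans q∣g (gcd[m,n]∣m e d)) q∤e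
  ... | yes _   | no _    | no _    = refl
  ... | no q∤d  | _       | yes q∣g = contradiction (∣-trans q∣g (gcd[m,n]∣n e d)) q∤d
  ... | no _    | _       | no _    = refl

  ∣?-*-cancelʳ : ∀ j m p .{{_ : NonZero p}} → ⌊ j * p ∣? m * p ⌋ ≡ ⌊ j ∣? m ⌋
  ∣?-*-cancelʳ j m p = ⌊⌋-⇔ (j * p ∣? m * p) (j ∣? m) (*-cancelʳ-∣ p) (*-monoˡ-∣ p)

  ∣?-*-prime : ∀ d m {p} → Prime p → p ∤ d → ⌊ d ∣? m * p ⌋ ≡ ⌊ d ∣? m ⌋
  ∣?-*-prime d m {p} pr p∤d = ⌊⌋-⇔ (d ∣? m * p) (d ∣? m) d∣mp⇒d∣m (∣m⇒∣m*n p)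
    where
    d∣mp⇒d∣m : d ∣ m * p → d ∣ m
    d∣mp⇒d∣m d∣mp = coprime-divisor (Coprimality.sym (prime∤⇒coprime pr p∤d)) (subst (d ∣_) (*-comm m p) d∣mp)

  ≟-*-cancelʳ : ∀ k l .{{_ : NonZero l}} → ⌊ k * l ≟ l ⌋ ≡ ⌊ k ≟ 1 ⌋
  ≟-*-cancelʳ k l = ⌊⌋-⇔ (k * l ≟ l) (k ≟ 1) (λ kl≡l → *-cancelʳ-≡ k 1 l (trans kl≡l (sym (*-identityˡ l))))
                                             (λ { refl → *-identityˡ l })


  -- `_/_` without its NonZero instance, so that it can be used under binders; m div 0 = 0 is junk.
  _div_ : ℕ → ℕ → ℕ
  m div zero  = 0
  m div suc n = m / suc n

  div-quotient : ∀ {m n} .{{_ : NonZero m}} (m∣n : m ∣ n) → n div m ≡ quotient m∣n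
  div-quotient {suc m} m∣n = n/m≡quotient m∣n

  *-div : ∀ m n .{{_ : NonZero n}} → (m * n) div n ≡ m
  *-div m n = div-quotient (n∣m*n m)

  anyTo-intro : ∀ n (P : ℕ → Bool) {k} → 1 ≤ k → k ≤ n → P k ≡ true → anyTo n P ≡ true
  anyTo-intro zero    P (s≤s z≤n) ()
  anyTo-intro (suc n) P {k} 1≤k k≤1+n Pk with k ≟ suc n
  ... | yes refl rewrite Pk = refl
  ... | no k≢1+n = trans (cong (P (suc n) ∨_) (anyTo-intro n P 1≤k k≤n Pk)) (∨-zeroʳ _)
    where k≤n = ≤-pred (≤∧≢⇒< k≤1+n k≢1+n)

  anyTo-elim : ∀ n (P : ℕ → Bool) → anyTo n P ≡ true → ∃[ k ] P k ≡ true
  anyTo-elim (suc n) P any with P (suc n) in Pn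
  ... | true  = suc n , Pn
  ... | false = anyTo-elim n P any

  hasSquareFactor-intro : ∀ n .{{_ : NonZero n}} {k} → 2 ≤ k → k * k ∣ n → hasSquareFactor n ≡ true
  hasSquareFactor-intro n {k} 2≤k k²∣n =
    anyTo-intro n _ (≤-trans (s≤s z≤n) 2≤k) (∣⇒≤ (∣-trans (m∣m*n k) k²∣n))
      (cong₂ _∧_ (⌊⌋-true (2 ≤? k) 2≤k) (⌊⌋-true (k * k ∣? n) k²∣n))

  hasSquareFactor-elim : ∀ n → hasSquareFactor n ≡ true → ∃[ k ] (2 ≤ k × k * k ∣ n)
  hasSquareFactor-elim n sq with anyTo-elim n _ sq
  ... | k , Pk with 2 ≤? k | k * k ∣? n
  ... | yes 2≤k | yes k²∣n = k , 2≤k , k²∣n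
  hasSquareFactor-elim n sq | k , () | yes _ | no _
  hasSquareFactor-elim n sq | k , () | no _  | _

  hasSquareFactor-*-prime : ∀ j {p} .{{_ : NonZero j}} → Prime p → p ∤ j →
                            hasSquareFactor (j * p) ≡ hasSquareFactor j
  hasSquareFactor-*-prime j {p} pr p∤j = ⇔→≡ {z = true} (mk⇔ to from)
    where
    instance
      _ = prime⇒nonZero pr
      _ = m*n≢0 j p
    to : hasSquareFactor (j * p) ≡ true → hasSquareFactor j ≡ true
    to sq with hasSquareFactor-elim (j * p) sq
    ... | k , 2≤k , k²∣jp with p ∣? k
    ... | yes p∣k = contradiction (*-cancelʳ-∣ p (∣-trans (*-pres-∣ p∣k p∣k) k²∣jp)) p∤j
    ... | no p∤k = hasSquareFactor-intro j 2≤k (coprime-divisor (Coprimality.sym p⊥k²) (subst (k * k ∣_) (*-comm j p) k²∣jp))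
      where
      p⊥k² : Coprime p (k * k)
      p⊥k² = prime∤⇒coprime pr λ p∣k² → [ p∤k , p∤k ]′ (euclidsLemma k k pr p∣k²)
    from : hasSquareFactor j ≡ true → hasSquareFactor (j * p) ≡ true
    from sq with hasSquareFactor-elim j sq
    ... | k , 2≤k , k²∣j = hasSquareFactor-intro (j * p) 2≤k (∣m⇒∣m*n p k²∣j)

  countTo-cong : ∀ n {P Q : ℕ → Bool} → (∀ {k} → k ≤ n → P k ≡ Q k) → countTo n P ≡ countTo n Q
  countTo-cong zero    P≗Q = refl
  countTo-cong (suc n) P≗Q =
    cong₂ (λ b c → (if b then 1 else 0) + c) (P≗Q ≤-refl) (countTo-cong n (P≗Q ∘ m≤n⇒m≤1+n))

  countTo-trim : ∀ {m} n (P : ℕ → Bool) → m ≤ n → (∀ {k} → m < k → P k ≡ false) →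
                 countTo n P ≡ countTo m P
  countTo-trim {m} zero    P z≤n _ = refl
  countTo-trim {m} (suc n) P m≤1+n vanish with m ≟ suc n
  ... | yes refl = refl
  ... | no m≢1+n = trans (cong (λ b → (if b then 1 else 0) + countTo n P) (vanish m<1+n))
                         (countTo-trim n P (≤-pred m<1+n) vanish)
    where m<1+n = ≤∧≢⇒< m≤1+n m≢1+n

  countTo-insert : ∀ n (P : ℕ → Bool) {p} → 1 ≤ p → p ≤ n → P p ≡ false →
                   countTo n (λ k → P k ∨ ⌊ k ≟ p ⌋) ≡ suc (countTo n P)
  countTo-insert zero    P (s≤s z≤n) ()
  countTo-insert (suc n) P {p} 1≤p p≤1+n Pp with suc n ≟ p
  ... | yes refl rewrite Pp = cong suc (countTo-cong n λ {k} k≤n →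
          trans (cong (P k ∨_) (⌊⌋-false (k ≟ suc n) λ { refl → 1+n≰n k≤n })) (∨-identityʳ _))
  ... | no 1+n≢p = trans
          (cong₂ (λ b c → (if b then 1 else 0) + c) (∨-identityʳ _)
            (countTo-insert n P 1≤p (≤-pred (≤∧≢⇒< p≤1+n (1+n≢p ∘ sym))) Pp))
          (+-suc _ _)

  ω-*-prime : ∀ j {p} .{{_ : NonZero j}} → Prime p → p ∤ j → ω (j * p) ≡ suc (ω j)
  ω-*-prime j {p} pr p∤j = begin
    countTo (j * p) primeDivisorOf[jp]                     ≡⟨ countTo-cong (j * p) (λ {k} _ → primeDivisors-split k) ⟩
    countTo (j * p) (λ k → primeDivisorOf[j] k ∨ ⌊ k ≟ p ⌋) ≡⟨ countTo-insert (j * p) primeDivisorOf[j] (>-nonZero⁻¹ p) (m≤n*m p j) p-new ⟩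
    suc (countTo (j * p) primeDivisorOf[j])                 ≡⟨ cong suc (countTo-trim (j * p) primeDivisorOf[j] (m≤m*n j p) beyond-j) ⟩
    suc (countTo j primeDivisorOf[j])                       ∎
    where
    open ≡-Reasoning
    instance _ = prime⇒nonZero pr
    primeDivisorOf[jp] primeDivisorOf[j] : ℕ → Bool
    primeDivisorOf[jp] k = ⌊ prime? k ⌋ ∧ ⌊ k ∣? j * p ⌋
    primeDivisorOf[j]  k = ⌊ prime? k ⌋ ∧ ⌊ k ∣? j ⌋
    p-new : primeDivisorOf[j] p ≡ false
    p-new = trans (cong (⌊ prime? p ⌋ ∧_) (⌊⌋-false (p ∣? j) p∤j)) (∧-zeroʳ _)
    beyond-j : ∀ {k} → j < k → primeDivisorOf[j] k ≡ false
    beyond-j {k} j<k = trans (cong (⌊ prime? k ⌋ ∧_) (⌊⌋-false (k ∣? j) (<⇒≱ j<k ∘ ∣⇒≤))) (∧-zeroʳ _)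
    primeDivisors-split : ∀ k → primeDivisorOf[jp] k ≡ primeDivisorOf[j] k ∨ ⌊ k ≟ p ⌋
    primeDivisors-split k with prime? k | k ∣? j * p | k ∣? j | k ≟ p
    ... | no ¬pk | _       | _     | yes refl = contradiction pr ¬pk
    ... | no _   | _       | _     | no _     = refl
    ... | yes _  | yes _   | yes _ | _        = refl
    ... | yes _  | yes _   | no _  | yes _    = refl
    ... | yes pk | yes k∣jp | no k∤j | no k≢p with euclidsLemma j p pk k∣jp
    ...   | inj₁ k∣j = contradiction k∣j k∤j
    ...   | inj₂ k∣p with prime⇒irreducible pr k∣p
    ...     | inj₁ refl = contradiction pk ¬prime[1]
    ...     | inj₂ k≡p  = contradiction k≡p k≢p
    primeDivisors-split k | yes _ | no k∤jp | yes k∣j | _      = contradiction (∣m⇒∣m*n p k∣j) k∤jp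
    primeDivisors-split k | yes _ | no k∤jp | no _    | yes refl = contradiction (n∣m*n j) k∤jp
    primeDivisors-split k | yes _ | no _    | no _    | no _   = refl

  μ-squareful : ∀ n .{{_ : NonZero n}} → hasSquareFactor n ≡ true → μ n ≡ + 0
  μ-squareful (suc n) sq rewrite sq = refl

  μ-newPrime : ∀ m n .{{_ : NonZero m}} .{{_ : NonZero n}} →
               hasSquareFactor m ≡ hasSquareFactor n → ω m ≡ suc (ω n) → μ m ≡ ℤ.- μ n
  μ-newPrime (suc m) (suc n) sq ω≡ rewrite sq | ω≡ with hasSquareFactor (suc n)
  ... | true  = refl
  ... | false = refl

  μ-*-prime-∣ : ∀ j {p} .{{_ : NonZero j}} → Prime p → p ∣ j → μ (j * p) ≡ + 0
  μ-*-prime-∣ j {p} pr p∣j = μ-squareful (j * p) (hasSquareFactor-intro (j * p) (nonTrivial⇒n>1 p) (*-monoˡ-∣ p p∣j))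
    where instance
      _ = prime⇒nonZero pr
      _ = prime⇒nonTrivial pr
      _ = m*n≢0 j p

  μ-*-prime-∤ : ∀ j {p} .{{_ : NonZero j}} → Prime p → p ∤ j → μ (j * p) ≡ ℤ.- μ j
  μ-*-prime-∤ j {p} pr p∤j = μ-newPrime (j * p) j (hasSquareFactor-*-prime j pr p∤j) (ω-*-prime j pr p∤j)
    where instance
      _ = prime⇒nonZero pr
      _ = m*n≢0 j p

  sumToℤ : ℕ → (ℕ → ℤ) → ℤ
  sumToℤ zero    t = + 0
  sumToℤ (suc n) t = sumToℤ n t ℤ.+ t (suc n)

  ramanujanSummand : ∀ {q h d} → Dec (d ∣ q) → Dec (d ∣ h) → ℤ
  ramanujanSummand {d = d} (yes d∣q) (yes _) = + d ℤ.* μ (quotient d∣q)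
  ramanujanSummand _ _ = + 0

  -- `ramanujan` accumulates in a local loop over a local summand that cannot be named here, so the
  -- left-hand sides `_` below are inferred from their uses; abstracting `suc q` (or `suc k`) and
  -- `ℤ._+_` turns each use into a pattern-unification problem that determines them.
  mutual
    ramanujan≡sumToℤ : ∀ q h → ramanujan q h ≡ sumToℤ q (λ d → ramanujanSummand (d ∣? q) (d ∣? h))
    ramanujan≡sumToℤ zero    h = refl
    ramanujan≡sumToℤ (suc q) h with suc q ∣? suc q | suc q ∣? h
    ... | d₁ | d₂ with suc q | ℤ._+_
    ... | q′ | plus = cong₂ plus (ramanujan-loop q′ h q) (ramanujan-term q′ h q′ d₁ d₂)

    ramanujan-loop : ∀ q h k → _ ≡ sumToℤ k (λ d → ramanujanSummand (d ∣? q) (d ∣? h))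
    ramanujan-loop q h zero    = refl
    ramanujan-loop q h (suc k) with suc k ∣? q | suc k ∣? h
    ... | d₁ | d₂ with suc k | ℤ._+_
    ... | d | plus = cong₂ plus (ramanujan-loop q h k) (ramanujan-term q h d d₁ d₂)

    ramanujan-term : ∀ q h d (d₁ : Dec (d ∣ q)) (d₂ : Dec (d ∣ h)) → _ ≡ ramanujanSummand d₁ d₂
    ramanujan-term q h d (yes _) (yes _) = refl
    ramanujan-term q h d (yes _) (no _)  = refl
    ramanujan-term q h d (no _)  _       = refl
open Arithmetic

open import Data.Bool using (true; false; not; _∧_)
open import Data.Integer as ℤ using (ℤ; +_; -[1+_]; _⊖_)
import Data.Integer.Properties as ℤ
open import Data.Nat as ℕ using (ℕ; zero; suc; z≤n; s≤s; NonZero; _≟_)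
import Data.Nat.Properties as ℕ
open import Data.Nat.Divisibility using (_∣?_; divides; quotient; n∣m*n; ∣⇒≤; ∣-refl; m*n∣⇒n∣)
open import Data.Nat.GCD using (gcd; gcd[m,n]≢0; gcd[m,n]≤n)
open import Data.Nat.Primality using (Prime; prime⇒nonZero)
open import Data.Product using (_,_)
open import Data.Sum using (inj₂)
open import Function using (_∘_)
open import Relation.Binary.PropositionalEquality as ≡ using (_≡_; _≢_)
open import Relation.Nullary using (yes; no; contradiction)
open import Relation.Nullary.Decidable using (⌊_⌋)

module _ {c ℓ} (R : CommutativeRing c ℓ) (inv : ℕ → CommutativeRing.Carrier R) where

  open CommutativeRing R
  open WithRing R inv
  open import Algebra.Properties.Ring ring using (-‿distribʳ-*; -‿involutive; -0#≈0#; -‿+-comm)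
  open import Algebra.Properties.Semiring.Mult semiring using (_×_; ×-homo-+; ×1-homo-*)
  open import Algebra.Properties.CommutativeSemigroup +-commutativeSemigroup using (interchange)
  open import Relation.Binary.Reasoning.Setoid setoid

  ιℕ≡×1# : ∀ n → ιℕ n ≡ n × 1#
  ιℕ≡×1# zero    = ≡.refl
  ιℕ≡×1# (suc n) = ≡.cong (_+_ 1#) (ιℕ≡×1# n)

  ιℕ-+ : ∀ m n → ιℕ (m ℕ.+ n) ≈ ιℕ m + ιℕ n
  ιℕ-+ m n rewrite ιℕ≡×1# (m ℕ.+ n) | ιℕ≡×1# m | ιℕ≡×1# n = ×-homo-+ 1# m n

  ιℕ-* : ∀ m n → ιℕ (m ℕ.* n) ≈ ιℕ m * ιℕ n
  ιℕ-* m n rewrite ιℕ≡×1# (m ℕ.* n) | ιℕ≡×1# m | ιℕ≡×1# n = ×1-homo-* m n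

  ιℤ-neg : ∀ z → ιℤ (ℤ.- z) ≈ - ιℤ z
  ιℤ-neg (+ zero)  = sym -0#≈0#
  ιℤ-neg (+ suc n) = refl
  ιℤ-neg -[1+ n ]  = sym (-‿involutive _)

  ιℤ-⊖ : ∀ m n → ιℤ (m ⊖ n) ≈ ιℕ m - ιℕ n
  ιℤ-⊖ m       zero    = begin
    ιℤ (m ⊖ 0)     ≡⟨ ≡.cong ιℤ (ℤ.⊖-≥ {m} z≤n) ⟩
    ιℕ m           ≈⟨ sym (+-identityʳ _) ⟩
    ιℕ m + 0#      ≈⟨ +-congˡ (sym -0#≈0#) ⟩
    ιℕ m - 0#      ∎
  ιℤ-⊖ zero    (suc n) = sym (+-identityˡ _)
  ιℤ-⊖ (suc m) (suc n) = begin
    ιℤ (suc m ⊖ suc n)             ≡⟨ ≡.cong ιℤ (ℤ.[1+m]⊖[1+n]≡m⊖n m n) ⟩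
    ιℤ (m ⊖ n)                     ≈⟨ ιℤ-⊖ m n ⟩
    ιℕ m - ιℕ n                    ≈⟨ +-congˡ (sym (+-identityˡ _)) ⟩
    ιℕ m + (0# - ιℕ n)             ≈⟨ +-congˡ (+-congʳ (sym (-‿inverseʳ 1#))) ⟩
    ιℕ m + ((1# - 1#) - ιℕ n)      ≈⟨ +-congˡ (+-assoc _ _ _) ⟩
    ιℕ m + (1# + (- 1# - ιℕ n))    ≈⟨ sym (+-assoc _ _ _) ⟩
    (ιℕ m + 1#) + (- 1# - ιℕ n)    ≈⟨ +-cong (+-comm _ _) (-‿+-comm 1# (ιℕ n)) ⟩
    (1# + ιℕ m) - (1# + ιℕ n)      ∎

  ιℤ-+ : ∀ x y → ιℤ (x ℤ.+ y) ≈ ιℤ x + ιℤ y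
  ιℤ-+ (+ m)    (+ n)    = ιℕ-+ m n
  ιℤ-+ (+ m)    -[1+ n ] = ιℤ-⊖ m (suc n)
  ιℤ-+ -[1+ m ] (+ n)    = trans (ιℤ-⊖ n (suc m)) (+-comm _ _)
  ιℤ-+ -[1+ m ] -[1+ n ] = begin
    - (1# + ιℕ (suc (m ℕ.+ n)))    ≈⟨ -‿cong (+-congˡ (ιℕ-+ (suc m) n)) ⟩
    - (1# + (ιℕ (suc m) + ιℕ n))   ≈⟨ -‿cong (sym (+-assoc _ _ _)) ⟩
    - ((1# + ιℕ (suc m)) + ιℕ n)   ≈⟨ -‿cong (+-congʳ (+-comm _ _)) ⟩
    - ((ιℕ (suc m) + 1#) + ιℕ n)   ≈⟨ -‿cong (+-assoc _ _ _) ⟩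
    - (ιℕ (suc m) + ιℕ (suc n))    ≈⟨ sym (-‿+-comm _ _) ⟩
    - ιℕ (suc m) - ιℕ (suc n)      ∎

  ιℤ-+* : ∀ n z → ιℤ (+ n ℤ.* z) ≈ ιℕ n * ιℤ z
  ιℤ-+* n (+ m)    = trans (reflexive (≡.cong ιℤ (ℤ.+◃n≡+n (n ℕ.* m)))) (ιℕ-* n m)
  ιℤ-+* n -[1+ m ] = begin
    ιℤ (+ n ℤ.* -[1+ m ])      ≡⟨ ≡.cong ιℤ (ℤ.-◃n≡-n (n ℕ.* suc m)) ⟩
    ιℤ (ℤ.- (+ (n ℕ.* suc m))) ≈⟨ ιℤ-neg (+ (n ℕ.* suc m)) ⟩
    - ιℕ (n ℕ.* suc m)         ≈⟨ -‿cong (ιℕ-* n (suc m)) ⟩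
    - (ιℕ n * ιℕ (suc m))      ≈⟨ -‿distribʳ-* _ _ ⟩
    ιℕ n * - ιℕ (suc m)        ∎

  sumTo-cong : ∀ n {F G : ℕ → Carrier} → (∀ k → F k ≈ G k) → sumTo n F ≈ sumTo n G
  sumTo-cong zero    F≈G = refl
  sumTo-cong (suc n) F≈G = +-cong (sumTo-cong n F≈G) (F≈G (suc n))

  sumTo-cong-≤ : ∀ n {F G : ℕ → Carrier} → (∀ {k} → 1 ℕ.≤ k → k ℕ.≤ n → F k ≈ G k) →
                 sumTo n F ≈ sumTo n G
  sumTo-cong-≤ zero    F≈G = refl
  sumTo-cong-≤ (suc n) F≈G =
    +-cong (sumTo-cong-≤ n λ 1≤k k≤n → F≈G 1≤k (ℕ.m≤n⇒m≤1+n k≤n)) (F≈G (s≤s z≤n) ℕ.≤-refl)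

  sumTo-zero : ∀ n {F : ℕ → Carrier} → (∀ {k} → 1 ℕ.≤ k → k ℕ.≤ n → F k ≈ 0#) → sumTo n F ≈ 0#
  sumTo-zero zero    F≈0 = refl
  sumTo-zero (suc n) F≈0 = trans (+-cong (sumTo-zero n λ 1≤k k≤n → F≈0 1≤k (ℕ.m≤n⇒m≤1+n k≤n))
                                          (F≈0 (s≤s z≤n) ℕ.≤-refl))
                                 (+-identityʳ 0#)

  sumTo-+ : ∀ n (F G : ℕ → Carrier) → sumTo n (λ k → F k + G k) ≈ sumTo n F + sumTo n G
  sumTo-+ zero    F G = sym (+-identityʳ 0#)
  sumTo-+ (suc n) F G = trans (+-congʳ (sumTo-+ n F G)) (interchange _ _ _ _)

  sumTo-neg : ∀ n (F : ℕ → Carrier) → sumTo n (λ k → - F k) ≈ - sumTo n F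
  sumTo-neg zero    F = sym -0#≈0#
  sumTo-neg (suc n) F = trans (+-congʳ (sumTo-neg n F)) (-‿+-comm _ _)

  *-distribˡ-sumTo : ∀ n x (F : ℕ → Carrier) → x * sumTo n F ≈ sumTo n (λ k → x * F k)
  *-distribˡ-sumTo zero    x F = zeroʳ x
  *-distribˡ-sumTo (suc n) x F = trans (distribˡ _ _ _) (+-congʳ (*-distribˡ-sumTo n x F))

  *-distribʳ-sumTo : ∀ n x (F : ℕ → Carrier) → sumTo n F * x ≈ sumTo n (λ k → F k * x)
  *-distribʳ-sumTo zero    x F = zeroˡ x
  *-distribʳ-sumTo (suc n) x F = trans (distribʳ _ _ _) (+-congʳ (*-distribʳ-sumTo n x F))

  sumTo-comm : ∀ m n (F : ℕ → ℕ → Carrier) →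
               sumTo m (λ i → sumTo n (F i)) ≈ sumTo n (λ j → sumTo m (λ i → F i j))
  sumTo-comm zero    n F = sym (sumTo-zero n λ _ _ → refl)
  sumTo-comm (suc m) n F = trans (+-congʳ (sumTo-comm m n F)) (sym (sumTo-+ n _ (F (suc m))))

  sumTo-trim : ∀ {m} n {F : ℕ → Carrier} → m ℕ.≤ n → (∀ {k} → m ℕ.< k → F k ≈ 0#) →
               sumTo n F ≈ sumTo m F
  sumTo-trim {m} zero    z≤n _ = refl
  sumTo-trim {m} (suc n) m≤1+n F≈0 with m ≟ suc n
  ... | yes ≡.refl = refl
  ... | no m≢1+n   = trans (+-cong (sumTo-trim n (ℕ.≤-pred m<1+n) F≈0) (F≈0 m<1+n)) (+-identityʳ _)
    where m<1+n = ℕ.≤∧≢⇒< m≤1+n m≢1+n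

  sumTo-shift : ∀ m n (F : ℕ → Carrier) → sumTo (m ℕ.+ n) F ≈ sumTo n F + sumTo m (λ k → F (k ℕ.+ n))
  sumTo-shift zero    n F = sym (+-identityʳ _)
  sumTo-shift (suc m) n F = trans (+-congʳ (sumTo-shift m n F)) (+-assoc _ _ _)

  sumTo-*-sumTo : ∀ n m (F G : ℕ → Carrier) z →
                  (sumTo n F * sumTo m G) * z ≈ sumTo n (λ i → sumTo m (λ j → (F i * G j) * z))
  sumTo-*-sumTo n m F G z = begin
    (sumTo n F * sumTo m G) * z               ≈⟨ *-congʳ (*-distribʳ-sumTo n (sumTo m G) F) ⟩
    sumTo n (λ i → F i * sumTo m G) * z       ≈⟨ *-distribʳ-sumTo n z _ ⟩
    sumTo n (λ i → (F i * sumTo m G) * z)     ≈⟨ sumTo-cong n (λ i → trans (*-congʳ (*-distribˡ-sumTo m (F i) G)) (*-distribʳ-sumTo m z _)) ⟩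
    sumTo n (λ i → sumTo m (λ j → (F i * G j) * z)) ∎

  sumTo-inward : ∀ n m (x : ℕ → ℕ → Carrier) (W : ℕ → ℕ → ℕ → Carrier) →
    sumTo n (λ i → sumTo m (λ d → sumTo m (λ e → x d e * W i d e))) ≈
    sumTo m (λ d → sumTo m (λ e → x d e * sumTo n (λ i → W i d e)))
  sumTo-inward n m x W = begin
    sumTo n (λ i → sumTo m (λ d → sumTo m (λ e → x d e * W i d e))) ≈⟨ sumTo-comm n m _ ⟩
    sumTo m (λ d → sumTo n (λ i → sumTo m (λ e → x d e * W i d e))) ≈⟨ sumTo-cong m (λ d → sumTo-comm n m _) ⟩
    sumTo m (λ d → sumTo m (λ e → sumTo n (λ i → x d e * W i d e))) ≈⟨ sumTo-cong m (λ d → sumTo-cong m λ e → *-distribˡ-sumTo n (x d e) _) ⟨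
    sumTo m (λ d → sumTo m (λ e → x d e * sumTo n (λ i → W i d e))) ∎

  when-true : ∀ {b} x → b ≡ true → when b x ≈ x
  when-true x ≡.refl = refl

  when-false : ∀ {b} x → b ≡ false → when b x ≈ 0#
  when-false x ≡.refl = refl

  when-≡ : ∀ {b c x} → b ≡ c → when b x ≈ when c x
  when-≡ ≡.refl = refl

  when-cong : ∀ b {x y} → x ≈ y → when b x ≈ when b y
  when-cong true  x≈y = x≈y
  when-cong false x≈y = refl

  when-0# : ∀ b → when b 0# ≈ 0#
  when-0# true  = refl
  when-0# false = refl

  when-neg : ∀ b x → when b (- x) ≈ - when b x
  when-neg true  x = refl
  when-neg false x = sym -0#≈0#

  when-comm : ∀ b c x → when b (when c x) ≈ when c (when b x)
  when-comm true  c     x = refl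
  when-comm false true  x = refl
  when-comm false false x = refl

  *-when : ∀ b x y → x * when b y ≈ when b (x * y)
  *-when true  x y = refl
  *-when false x y = zeroʳ x

  when-sumTo : ∀ b n (F : ℕ → Carrier) → when b (sumTo n F) ≈ sumTo n (λ k → when b (F k))
  when-sumTo true  n F = refl
  when-sumTo false n F = sym (sumTo-zero n λ _ _ → refl)

  when-*-sumTo : ∀ b n x (F : ℕ → Carrier) → when b (x * sumTo n F) ≈ sumTo n (λ k → when b (x * F k))
  when-*-sumTo b n x F = trans (when-cong b (*-distribˡ-sumTo n x F)) (when-sumTo b n _)

  when-partition : ∀ b x → x ≈ when (not b) x + when b x
  when-partition true  x = sym (+-identityˡ x)
  when-partition false x = sym (+-identityʳ x)

  sumTo-single : ∀ n {g} (F : ℕ → Carrier) → 1 ℕ.≤ g → g ℕ.≤ n →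
                 sumTo n (λ l → when ⌊ g ≟ l ⌋ (F l)) ≈ F g
  sumTo-single zero    F (s≤s z≤n) ()
  sumTo-single (suc n) {g} F 1≤g g≤1+n with g ≟ suc n
  ... | yes ≡.refl = trans (+-congʳ (sumTo-zero n λ {l} _ l≤n →
                             when-false (F l) (⌊⌋-false (suc n ≟ l) λ { ≡.refl → ℕ.1+n≰n l≤n })))
                           (+-identityˡ _)
  ... | no g≢1+n   = trans (+-identityʳ _) (sumTo-single n F 1≤g (ℕ.≤-pred (ℕ.≤∧≢⇒< g≤1+n g≢1+n)))

  sumTo-multiples : ∀ l .{{_ : NonZero l}} K (F : ℕ → Carrier) →
                    sumTo (K ℕ.* l) (λ q → when ⌊ l ∣? q ⌋ (F q)) ≈ sumTo K (λ j → F (j ℕ.* l))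
  sumTo-multiples l zero    F = refl
  sumTo-multiples l@(suc l′) (suc K) F = begin
    sumTo (l ℕ.+ K ℕ.* l) G                                ≈⟨ sumTo-shift l (K ℕ.* l) G ⟩
    sumTo (K ℕ.* l) G + sumTo l (λ k → G (k ℕ.+ K ℕ.* l))  ≈⟨ +-cong (sumTo-multiples l K F) last-block ⟩
    sumTo K (λ j → F (j ℕ.* l)) + F (suc K ℕ.* l)          ∎
    where
    G : ℕ → Carrier
    G q = when ⌊ l ∣? q ⌋ (F q)
    last-block : sumTo l (λ k → G (k ℕ.+ K ℕ.* l)) ≈ F (l ℕ.+ K ℕ.* l)
    last-block = trans
      (+-cong (sumTo-zero l′ λ {k} 1≤k k≤l′ →
                 when-false (F (k ℕ.+ K ℕ.* l)) (⌊⌋-false (l ∣? k ℕ.+ K ℕ.* l) (∤-offset K 1≤k (s≤s k≤l′))))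
              (when-true (F (l ℕ.+ K ℕ.* l)) (⌊⌋-true (l ∣? l ℕ.+ K ℕ.* l) (n∣m*n (suc K)))))
      (+-identityˡ _)

  möbiusSum : ℕ → Carrier
  möbiusSum n = sumTo n (λ d → when ⌊ d ∣? n ⌋ (ιℤ (μ d)))

  -- Divisors prime to p cancel against their multiples by p, since μ(jp) = -μ(j) when p ∤ j.
  möbiusSum-*-prime : ∀ m {p} → 1 ℕ.≤ m → Prime p → möbiusSum (m ℕ.* p) ≈ 0#
  möbiusSum-*-prime m {p} 1≤m pr = begin
    sumTo n M                                                               ≈⟨ sumTo-cong n (λ d → when-partition ⌊ p ∣? d ⌋ (M d)) ⟩
    sumTo n (λ d → when (not ⌊ p ∣? d ⌋) (M d) + when ⌊ p ∣? d ⌋ (M d))      ≈⟨ sumTo-+ n _ _ ⟩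
    sumTo n (λ d → when (not ⌊ p ∣? d ⌋) (M d)) + sumTo n (λ d → when ⌊ p ∣? d ⌋ (M d))
      ≈⟨ +-cong (trans (sumTo-cong n p∤-part) (sumTo-trim n (ℕ.m≤m*n m p) beyond-m)) (sumTo-multiples p m M) ⟩
    S + sumTo m (λ j → M (j ℕ.* p))                                         ≈⟨ +-congˡ (trans (sumTo-cong-≤ m p∣-part) (sumTo-neg m _)) ⟩
    S - S                                                                   ≈⟨ -‿inverseʳ S ⟩
    0#                                                                      ∎
    where
    instance _ = prime⇒nonZero pr
    n : ℕ
    n = m ℕ.* p
    M coprimeDivisor : ℕ → Carrier
    M d = when ⌊ d ∣? n ⌋ (ιℤ (μ d))
    coprimeDivisor d = when (not ⌊ p ∣? d ⌋) (when ⌊ d ∣? m ⌋ (ιℤ (μ d)))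
    S : Carrier
    S = sumTo m coprimeDivisor
    p∤-part : ∀ d → when (not ⌊ p ∣? d ⌋) (M d) ≈ coprimeDivisor d
    p∤-part d with p ∣? d
    ... | yes _  = refl
    ... | no p∤d = when-≡ (∣?-*-prime d m pr p∤d)
    beyond-m : ∀ {d} → m ℕ.< d → coprimeDivisor d ≈ 0#
    beyond-m {d} m<d = trans (when-cong (not ⌊ p ∣? d ⌋) (when-false _ (⌊⌋-false (d ∣? m) (ℕ.<⇒≱ m<d ∘ ∣⇒≤))))
                             (when-0# (not ⌊ p ∣? d ⌋))
      where instance _ = ℕ.>-nonZero 1≤m
    p∣-part : ∀ {j} → 1 ℕ.≤ j → j ℕ.≤ m → M (j ℕ.* p) ≈ - coprimeDivisor j
    p∣-part {j} 1≤j _ with p ∣? j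
    ... | yes p∣j = begin
      when ⌊ j ℕ.* p ∣? n ⌋ (ιℤ (μ (j ℕ.* p)))  ≡⟨ ≡.cong (λ z → when ⌊ j ℕ.* p ∣? n ⌋ (ιℤ z)) (μ-*-prime-∣ j pr p∣j) ⟩
      when ⌊ j ℕ.* p ∣? n ⌋ 0#                  ≈⟨ when-0# ⌊ j ℕ.* p ∣? n ⌋ ⟩
      0#                                        ≈⟨ -0#≈0# ⟨
      - 0#                                      ∎
      where instance _ = ℕ.>-nonZero 1≤j
    ... | no p∤j = begin
      when ⌊ j ℕ.* p ∣? n ⌋ (ιℤ (μ (j ℕ.* p)))  ≡⟨ ≡.cong₂ (λ b z → when b (ιℤ z)) (∣?-*-cancelʳ j m p) (μ-*-prime-∤ j pr p∤j) ⟩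
      when ⌊ j ∣? m ⌋ (ιℤ (ℤ.- μ j))            ≈⟨ when-cong ⌊ j ∣? m ⌋ (ιℤ-neg (μ j)) ⟩
      when ⌊ j ∣? m ⌋ (- ιℤ (μ j))              ≈⟨ when-neg ⌊ j ∣? m ⌋ (ιℤ (μ j)) ⟩
      - when ⌊ j ∣? m ⌋ (ιℤ (μ j))              ∎
      where instance _ = ℕ.>-nonZero 1≤j

  möbiusSum-≥2 : ∀ n → 2 ℕ.≤ n → möbiusSum n ≈ 0#
  möbiusSum-≥2 n 2≤n with prime-divisor n 2≤n
  ... | p , pr , divides m n≡m*p =
    ≡.subst (λ k → möbiusSum k ≈ 0#) (≡.sym n≡m*p) (möbiusSum-*-prime m (ℕ.n≢0⇒n>0 m≢0) pr)
    where
    m≢0 : m ≢ 0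
    m≢0 ≡.refl = contradiction (≡.subst (2 ℕ.≤_) n≡m*p 2≤n) λ ()

  möbiusSum≈[n≡1] : ∀ n → 1 ℕ.≤ n → möbiusSum n ≈ when ⌊ n ≟ 1 ⌋ 1#
  möbiusSum≈[n≡1] (suc zero)    _ = trans (+-identityˡ _) (+-identityʳ _)
  möbiusSum≈[n≡1] (suc (suc n)) _ = möbiusSum-≥2 (suc (suc n)) (s≤s (s≤s z≤n))

  möbius-multiples : ∀ N {l g} .{{_ : NonZero l}} → 1 ℕ.≤ g → g ℕ.≤ N →
                     sumTo N (λ j → when ⌊ j ℕ.* l ∣? g ⌋ (ιℤ (μ j))) ≈ when ⌊ g ≟ l ⌋ 1#
  möbius-multiples N {l} {g} 1≤g g≤N with l ∣? g
  ... | no l∤g = trans (sumTo-zero N λ {j} _ _ → when-false _ (⌊⌋-false (j ℕ.* l ∣? g) (l∤g ∘ m*n∣⇒n∣ j l)))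
                       (sym (when-false 1# (⌊⌋-false (g ≟ l) λ { ≡.refl → l∤g ∣-refl })))
  ... | yes (divides k ≡.refl) = begin
    sumTo N (λ j → when ⌊ j ℕ.* l ∣? k ℕ.* l ⌋ (ιℤ (μ j)))  ≈⟨ sumTo-cong N (λ j → when-≡ (∣?-*-cancelʳ j k l)) ⟩
    sumTo N (λ j → when ⌊ j ∣? k ⌋ (ιℤ (μ j)))              ≈⟨ sumTo-trim N (ℕ.≤-trans (ℕ.m≤m*n k l) g≤N) beyond-k ⟩
    möbiusSum k                                              ≈⟨ möbiusSum≈[n≡1] k (ℕ.n≢0⇒n>0 k≢0) ⟩
    when ⌊ k ≟ 1 ⌋ 1#                                        ≈⟨ when-≡ (≟-*-cancelʳ k l) ⟨
    when ⌊ k ℕ.* l ≟ l ⌋ 1#                                  ∎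
    where
    k≢0 : k ≢ 0
    k≢0 ≡.refl = contradiction 1≤g λ ()
    beyond-k : ∀ {j} → k ℕ.< j → when ⌊ j ∣? k ⌋ (ιℤ (μ j)) ≈ 0#
    beyond-k {j} k<j = when-false _ (⌊⌋-false (j ∣? k) (ℕ.<⇒≱ k<j ∘ ∣⇒≤))
      where instance _ = ℕ.>-nonZero (ℕ.n≢0⇒n>0 k≢0)

  möbius-interval : ∀ N {l g} .{{_ : NonZero l}} → 1 ℕ.≤ g → g ℕ.≤ N →
    sumTo N (λ q → when ⌊ l ∣? q ⌋ (when ⌊ q ∣? g ⌋ (ιℤ (μ (q div l))))) ≈ when ⌊ g ≟ l ⌋ 1#
  möbius-interval N {l} {g} 1≤g g≤N = begin
    sumTo N (λ q → when ⌊ l ∣? q ⌋ (D q))         ≈⟨ sumTo-trim (N ℕ.* l) (ℕ.m≤m*n N l) beyond-g ⟨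
    sumTo (N ℕ.* l) (λ q → when ⌊ l ∣? q ⌋ (D q))  ≈⟨ sumTo-multiples l N D ⟩
    sumTo N (λ j → D (j ℕ.* l))                     ≈⟨ sumTo-cong N (λ j → when-cong _ (reflexive (≡.cong (ιℤ ∘ μ) (*-div j l)))) ⟩
    sumTo N (λ j → when ⌊ j ℕ.* l ∣? g ⌋ (ιℤ (μ j))) ≈⟨ möbius-multiples N 1≤g g≤N ⟩
    when ⌊ g ≟ l ⌋ 1#                                ∎
    where
    D : ℕ → Carrier
    D q = when ⌊ q ∣? g ⌋ (ιℤ (μ (q div l)))
    beyond-g : ∀ {q} → N ℕ.< q → when ⌊ l ∣? q ⌋ (D q) ≈ 0#
    beyond-g {q} N<q = trans (when-cong ⌊ l ∣? q ⌋ (when-false _ (⌊⌋-false (q ∣? g) (ℕ.<⇒≱ (ℕ.≤-<-trans g≤N N<q) ∘ ∣⇒≤))))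
                             (when-0# ⌊ l ∣? q ⌋)
      where instance _ = ℕ.>-nonZero 1≤g

  ramanujanTerm : ℕ → ℕ → ℕ → Carrier
  ramanujanTerm q h l = when ⌊ l ∣? h ⌋ (ιℕ l * when ⌊ l ∣? q ⌋ (ιℤ (μ (q div l))))

  ιℤ-sumToℤ : ∀ n (t : ℕ → ℤ) → ιℤ (sumToℤ n t) ≈ sumTo n (ιℤ ∘ t)
  ιℤ-sumToℤ zero    t = refl
  ιℤ-sumToℤ (suc n) t = trans (ιℤ-+ (sumToℤ n t) (t (suc n))) (+-congʳ (ιℤ-sumToℤ n t))

  ιℤ-ramanujanSummand : ∀ q h d .{{_ : NonZero d}} →
                        ιℤ (ramanujanSummand (d ∣? q) (d ∣? h)) ≈ ramanujanTerm q h d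
  ιℤ-ramanujanSummand q h d with d ∣? q | d ∣? h
  ... | yes d∣q | yes _ = trans (ιℤ-+* d (μ (quotient d∣q)))
                                (*-congˡ (reflexive (≡.cong (ιℤ ∘ μ) (≡.sym (div-quotient d∣q)))))
  ... | yes _   | no _  = refl
  ... | no _    | yes _ = sym (zeroʳ (ιℕ d))
  ... | no _    | no _  = refl

  ramanujan≈sumTo : ∀ N {q} h → 1 ℕ.≤ q → q ℕ.≤ N → ιℤ (ramanujan q h) ≈ sumTo N (ramanujanTerm q h)
  ramanujan≈sumTo N {q} h 1≤q q≤N = begin
    ιℤ (ramanujan q h)                                          ≡⟨ ≡.cong ιℤ (ramanujan≡sumToℤ q h) ⟩
    ιℤ (sumToℤ q (λ d → ramanujanSummand (d ∣? q) (d ∣? h)))    ≈⟨ ιℤ-sumToℤ q _ ⟩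
    sumTo q (λ d → ιℤ (ramanujanSummand (d ∣? q) (d ∣? h)))     ≈⟨ sumTo-cong-≤ q (λ {d} 1≤d _ → ιℤ-ramanujanSummand q h d {{ℕ.>-nonZero 1≤d}}) ⟩
    sumTo q (ramanujanTerm q h)                                 ≈⟨ sumTo-trim N q≤N beyond-q ⟨
    sumTo N (ramanujanTerm q h)                                 ∎
    where
    beyond-q : ∀ {l} → q ℕ.< l → ramanujanTerm q h l ≈ 0#
    beyond-q {l} q<l = trans (when-cong ⌊ l ∣? h ⌋ (trans (*-congˡ (when-false _ (⌊⌋-false (l ∣? q) (ℕ.<⇒≱ q<l ∘ ∣⇒≤))))
                                                             (zeroʳ (ιℕ l))))
                             (when-0# ⌊ l ∣? h ⌋)
      where instance _ = ℕ.>-nonZero 1≤q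

  ramanujan-divisorSum : ∀ N h {g} → 1 ℕ.≤ g → g ℕ.≤ N →
    sumTo N (λ q → when ⌊ q ∣? g ⌋ (ιℤ (ramanujan q h))) ≈ when ⌊ g ∣? h ⌋ (ιℕ g)
  ramanujan-divisorSum N h {g} 1≤g g≤N = begin
    sumTo N (λ q → when ⌊ q ∣? g ⌋ (ιℤ (ramanujan q h)))
      ≈⟨ sumTo-cong-≤ N (λ {q} 1≤q q≤N → trans (when-cong ⌊ q ∣? g ⌋ (ramanujan≈sumTo N h 1≤q q≤N)) (when-sumTo ⌊ q ∣? g ⌋ N _)) ⟩
    sumTo N (λ q → sumTo N (λ l → when ⌊ q ∣? g ⌋ (ramanujanTerm q h l)))
      ≈⟨ sumTo-comm N N _ ⟩
    sumTo N (λ l → sumTo N (λ q → when ⌊ q ∣? g ⌋ (ramanujanTerm q h l)))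
      ≈⟨ sumTo-cong-≤ N (λ {l} 1≤l _ → divisorsOf-g l {{ℕ.>-nonZero 1≤l}}) ⟩
    sumTo N (λ l → when ⌊ g ≟ l ⌋ (when ⌊ l ∣? h ⌋ (ιℕ l)))
      ≈⟨ sumTo-single N _ 1≤g g≤N ⟩
    when ⌊ g ∣? h ⌋ (ιℕ g) ∎
    where
    move-inward : ∀ b c d x y → when b (when c (x * when d y)) ≈ when c (x * when d (when b y))
    move-inward true  c d x y = refl
    move-inward false c d x y = sym (trans (when-cong c (trans (*-congˡ (when-0# d)) (zeroʳ x))) (when-0# c))
    divisorsOf-g : ∀ l .{{_ : NonZero l}} →
      sumTo N (λ q → when ⌊ q ∣? g ⌋ (ramanujanTerm q h l)) ≈ when ⌊ g ≟ l ⌋ (when ⌊ l ∣? h ⌋ (ιℕ l))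
    divisorsOf-g l = begin
      sumTo N (λ q → when ⌊ q ∣? g ⌋ (ramanujanTerm q h l))
        ≈⟨ sumTo-cong N (λ q → move-inward ⌊ q ∣? g ⌋ ⌊ l ∣? h ⌋ ⌊ l ∣? q ⌋ (ιℕ l) _) ⟩
      sumTo N (λ q → when ⌊ l ∣? h ⌋ (ιℕ l * I q))
        ≈⟨ when-sumTo ⌊ l ∣? h ⌋ N _ ⟨
      when ⌊ l ∣? h ⌋ (sumTo N (λ q → ιℕ l * I q))
        ≈⟨ when-cong ⌊ l ∣? h ⌋ (*-distribˡ-sumTo N (ιℕ l) I) ⟨
      when ⌊ l ∣? h ⌋ (ιℕ l * sumTo N I)
        ≈⟨ when-cong ⌊ l ∣? h ⌋ (*-congˡ (möbius-interval N 1≤g g≤N)) ⟩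
      when ⌊ l ∣? h ⌋ (ιℕ l * when ⌊ g ≟ l ⌋ 1#)
        ≈⟨ when-cong ⌊ l ∣? h ⌋ (trans (*-when ⌊ g ≟ l ⌋ _ _) (when-cong ⌊ g ≟ l ⌋ (*-identityʳ _))) ⟩
      when ⌊ l ∣? h ⌋ (when ⌊ g ≟ l ⌋ (ιℕ l))
        ≈⟨ when-comm ⌊ l ∣? h ⌋ ⌊ g ≟ l ⌋ _ ⟩
      when ⌊ g ≟ l ⌋ (when ⌊ l ∣? h ⌋ (ιℕ l)) ∎
      where
      I : ℕ → Carrier
      I q = when ⌊ l ∣? q ⌋ (when ⌊ q ∣? g ⌋ (ιℤ (μ (q div l))))

  module _ (f g : ℕ → Carrier) (h N : ℕ) where

    private
      a b : ℕ → Carrier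
      a d = eratosthenes f d * inv d
      b e = eratosthenes g e * inv e

      1≤gcd : ∀ {d} e → 1 ℕ.≤ d → 1 ℕ.≤ gcd e d
      1≤gcd {d} e 1≤d = ℕ.n≢0⇒n>0 (gcd[m,n]≢0 e d (inj₂ (ℕ.≢-nonZero⁻¹ d)))
        where instance _ = ℕ.>-nonZero 1≤d

      gcd≤N : ∀ {d} e → 1 ℕ.≤ d → d ℕ.≤ N → gcd e d ℕ.≤ N
      gcd≤N {d} e 1≤d d≤N = ℕ.≤-trans (gcd[m,n]≤n e d) d≤N
        where instance _ = ℕ.>-nonZero 1≤d

    gcdSum : Carrier
    gcdSum = sumTo N (λ d → sumTo N (λ e → (a d * b e) * when ⌊ gcd e d ∣? h ⌋ (ιℕ (gcd e d))))

    singularSeries≈gcdSum : singularSeries N f g h ≈ gcdSum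
    singularSeries≈gcdSum = begin
      singularSeries N f g h
        ≈⟨ sumTo-cong N expand ⟩
      sumTo N (λ q → sumTo N (λ d → sumTo N (λ e → (a d * b e) * when ⌊ q ∣? gcd e d ⌋ (ιℤ (ramanujan q h)))))
        ≈⟨ sumTo-inward N N _ _ ⟩
      sumTo N (λ d → sumTo N (λ e → (a d * b e) * sumTo N (λ q → when ⌊ q ∣? gcd e d ⌋ (ιℤ (ramanujan q h)))))
        ≈⟨ sumTo-cong-≤ N (λ 1≤d d≤N → sumTo-cong N λ e → *-congˡ (ramanujan-divisorSum N h (1≤gcd e 1≤d) (gcd≤N e 1≤d d≤N))) ⟩
      gcdSum ∎
      where
      common-divisor : ∀ b₁ b₂ x y z → (when b₁ x * when b₂ y) * z ≈ (x * y) * when (b₁ ∧ b₂) z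
      common-divisor true  true  x y z = refl
      common-divisor true  false x y z = trans (*-congʳ (zeroʳ x)) (trans (zeroˡ z) (sym (zeroʳ _)))
      common-divisor false b₂    x y z = trans (*-congʳ (zeroˡ _)) (trans (zeroˡ z) (sym (zeroʳ _)))
      expand : ∀ q → ramanujanCoeff N f q * ramanujanCoeff N g q * ιℤ (ramanujan q h) ≈
                     sumTo N (λ d → sumTo N (λ e → (a d * b e) * when ⌊ q ∣? gcd e d ⌋ (ιℤ (ramanujan q h))))
      expand q = trans (sumTo-*-sumTo N N _ _ _) (sumTo-cong N λ d → sumTo-cong N λ e →
        trans (common-divisor ⌊ q ∣? d ⌋ ⌊ q ∣? e ⌋ _ _ _) (*-congˡ (when-≡ (∣?-gcd q d e))))

    rhsA6≈gcdSum : rhsA6 N f g h ≈ gcdSum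
    rhsA6≈gcdSum = begin
      rhsA6 N f g h
        ≈⟨ sumTo-cong N expand ⟩
      sumTo N (λ l → sumTo N (λ d → sumTo N (λ e → (a d * b e) * when ⌊ gcd e d ≟ l ⌋ (when ⌊ l ∣? h ⌋ (ιℕ l)))))
        ≈⟨ sumTo-inward N N _ _ ⟩
      sumTo N (λ d → sumTo N (λ e → (a d * b e) * sumTo N (λ l → when ⌊ gcd e d ≟ l ⌋ (when ⌊ l ∣? h ⌋ (ιℕ l)))))
        ≈⟨ sumTo-cong-≤ N (λ 1≤d d≤N → sumTo-cong N λ e → *-congˡ (sumTo-single N _ (1≤gcd e 1≤d) (gcd≤N e 1≤d d≤N))) ⟩
      gcdSum ∎
      where
      rearrange : ∀ b c L x y → when b (L * (x * when c y)) ≈ (x * y) * when c (when b L)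
      rearrange true  true  L x y = *-comm L (x * y)
      rearrange true  false L x y = trans (*-congˡ (zeroʳ x)) (trans (zeroʳ L) (sym (zeroʳ _)))
      rearrange false c     L x y = sym (trans (*-congˡ (when-0# c)) (zeroʳ _))
      expand : ∀ l → when ⌊ l ∣? h ⌋ (ιℕ l * sumTo N (λ d → a d * sumTo N (λ e → when ⌊ gcd e d ≟ l ⌋ (b e)))) ≈
                     sumTo N (λ d → sumTo N (λ e → (a d * b e) * when ⌊ gcd e d ≟ l ⌋ (when ⌊ l ∣? h ⌋ (ιℕ l))))
      expand l = trans (when-*-sumTo ⌊ l ∣? h ⌋ N (ιℕ l) _) (sumTo-cong N λ d →
        trans (when-cong ⌊ l ∣? h ⌋ (*-congˡ (*-distribˡ-sumTo N (a d) _)))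
        (trans (when-*-sumTo ⌊ l ∣? h ⌋ N (ιℕ l) _)
               (sumTo-cong N λ e → rearrange ⌊ l ∣? h ⌋ ⌊ gcd e d ≟ l ⌋ (ιℕ l) (a d) (b e))))

    singularSeries≈rhsA6 : singularSeries N f g h ≈ rhsA6 N f g h
    singularSeries≈rhsA6 = trans singularSeries≈gcdSum (sym rhsA6≈gcdSum)

lemmaA6 : ∀ {c ℓ} (R : CommutativeRing c ℓ) (inv : ℕ → CommutativeRing.Carrier R)
            → WithRing.InvertsPositive R inv
            → (f g : ℕ → CommutativeRing.Carrier R) (h N : ℕ)
            → WithRing.SupportedUpTo R inv N (WithRing.eratosthenes R inv f)
            → WithRing.SupportedUpTo R inv N (WithRing.eratosthenes R inv g)
            → CommutativeRing._≈_ R (WithRing.singularSeries R inv N f g h)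
                                    (WithRing.rhsA6 R inv N f g h)
lemmaA6 R inv _ f g h N _ _ = singularSeries≈rhsA6 R inv f g h N
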